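{- Let $s \ge 1$ and $D \ge 1$ be integers. Let $G=(V,E)$ be the communication network and let $Q \subseteq V$ be such that every $v \in V$ has $d^s(v,Q)\le D$. Each $v \in V$ has a unique $a$-bit identifier $\operatorname{ID}(v)$, and messages have $\mathsf{bandwidth}$ bits. If every $v \in V$ knows the set of identifiers of $N^{s}(v,Q)$, then there is a deterministic algorithm after which every $v \in V$ knows the set of identifiers of $N^{s+1}(v,Q)$, running in $O(D \cdot a / \mathsf{bandwidth})$ rounds. Furthermore, if for each $v \in Q$ a BFS tree $T_v$ of depth $s$ rooted at $v$ is given distributedly, then each such tree can be extended to a BFS tree of depth $s+1$ rooted at $v$, given distributedly, in additional $O(D \cdot a / \mathsf{bandwidth})$ rounds.
   Context: Synchronous message passing on $G$: in each round each node may send a $\mathsf{bandwidth}$-bit message to each neighbor. $N^s(v)$ is the set of nodes $w\neq v$ with $\operatorname{dist}_G(v,w)\le s$, $N^s(v,X)=N^s(v)\cap X$, $d^s(v,X)=|N^s(v,X)|$, $N(v)=N^1(v)$. A BFS tree of depth $s$ rooted at $r$ is a tree subgraph $T$ of $G$ with vertex set $N^s(r)\cup\{r\}$ such that $\operatorname{dist}_T(v,r)=\operatorname{dist}_G(v,r)$ for all $v\in V(T)$; it is given distributedly if every $v\in V(T)$ knows its parent in $T$, its children in $T$ (as neighbors in $G$), and the identifier of the root. -}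

module Defs where

open import Data.Nat using (ℕ; zero; suc; _≤_; _<_)
open import Data.Fin using (Fin)
open import Data.Bool using (Bool; true)
open import Data.Vec using (Vec)
open import Data.List using (List; length)
open import Data.List.Membership.Propositional using (_∈_)
open import Data.List.Relation.Unary.All using (All)
open import Data.List.Relation.Unary.Unique.Propositional using (Unique)
open import Data.Maybe using (Maybe; just; nothing)
open import Data.Product using (Σ; ∃; ∃₂; _×_; _,_)
open import Data.Sum using (_⊎_)
open import Relation.Binary.PropositionalEquality using (_≡_; _≢_)
open import Relation.Nullary using (¬_)
open import Function.Definitions using (Injective)

-- Communication network: a finite simple undirected graph on Fin n,
-- given with port numbering (node v addresses its neighbours through
-- ports Fin (deg v)).

record Graph (n : ℕ) : Set where
  field
    deg     : Fin n → ℕ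
    nbr     : (v : Fin n) → Fin (deg v) → Fin n
    nbr-inj : ∀ v → Injective _≡_ _≡_ (nbr v)
    no-loop : ∀ v p → nbr v p ≢ v
    back    : ∀ v p → Fin (deg (nbr v p))
    back-ok : ∀ v p → nbr (nbr v p) (back v p) ≡ v

open Graph public

module _ {n : ℕ} (G : Graph n) where

  Adj : Fin n → Fin n → Set
  Adj v w = ∃ λ p → nbr G v p ≡ w

  data Within : ℕ → Fin n → Fin n → Set where
    here : ∀ {k v} → Within k v v
    step : ∀ {k v u w} → Adj v u → Within k u w → Within (suc k) v w

  Dist : Fin n → Fin n → ℕ → Set
  Dist u w k = Within k u w × (∀ j → j < k → ¬ Within j u w)

  Ball : ℕ → Fin n → Fin n → Set
  Ball s v w = w ≢ v × Within s v w

  BallQ : ℕ → Fin n → (Fin n → Bool) → Fin n → Set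
  BallQ s v Q w = Ball s v w × Q w ≡ true

  -- BFS tree of depth s rooted at r, as parent pointers.
  -- Vertex set: {x | dist(r,x) ≤ s} = N^s(r) ∪ {r}.  Every non-root
  -- vertex x has a parent adjacent to it, one step closer to r; this is
  -- exactly a spanning tree of the vertex set with dist_T(x,r)=dist_G(x,r).
  record BFSTree (s : ℕ) (r : Fin n) : Set where
    field
      parent      : Fin n → Fin n
      parent-adj  : ∀ x → Within s r x → x ≢ r → Adj x (parent x)
      parent-dist : ∀ x → Within s r x → x ≢ r →
                    ∀ k → Dist r x (suc k) → Dist r (parent x) k

  open BFSTree public

  IsChild : ∀ {s r} → BFSTree s r → Fin n → Fin n → Set
  IsChild {s} {r} T v x = Within s r x × x ≢ r × parent T x ≡ v

  Extends : ∀ {s s' r} → BFSTree s r → BFSTree s' r → Set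
  Extends {s} {s'} {r} T T' =
    ∀ x → Within s r x → x ≢ r → parent T' x ≡ parent T x

  TreeFamily : ℕ → (Fin n → Bool) → Set
  TreeFamily s Q = (u : Fin n) → Q u ≡ true → BFSTree s u

Id : ℕ → Set
Id a = Vec Bool a

CardLe : ∀ {n} → (Fin n → Set) → ℕ → Set
CardLe {n} P D = ∀ (xs : List (Fin n)) → Unique xs → All P xs → length xs ≤ D

KnowsIds : ∀ {n a} → (Fin n → Id a) → (Fin n → Set) → List (Id a) → Set
KnowsIds {n} ID P L =
  ∀ x → (x ∈ L → ∃ λ w → P w × ID w ≡ x) × ((∃ λ w → P w × ID w ≡ x) → x ∈ L)

-- Local knowledge of node (of degree d) about one tree it belongs to:
-- identifier of the root, parent port (nothing at the root), child ports.
record TreeEntry (a d : ℕ) : Set where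
  constructor entry
  field
    root     : Id a
    par      : Maybe (Fin d)
    children : List (Fin d)

open TreeEntry public

module _ {n a : ℕ} (G : Graph n) (ID : Fin n → Id a) where

  Describes : ∀ {s r} → BFSTree G s r → (v : Fin n) → TreeEntry a (deg G v) → Set
  Describes {s} {r} T v e =
    root e ≡ ID r × Within G s r v ×
    ((v ≡ r × par e ≡ nothing) ⊎
     (v ≢ r × ∃ λ p → par e ≡ just p × nbr G v p ≡ parent T v)) ×
    (∀ q → (q ∈ children e → IsChild G T v (nbr G v q)) ×
           (IsChild G T v (nbr G v q) → q ∈ children e))

  -- the list L is node v's part of the distributed representation of the
  -- family of trees Tf (one tree per u ∈ Q)
  Encodes : ∀ {s Q} → TreeFamily G s Q → (v : Fin n) →
            List (TreeEntry a (deg G v)) → Set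
  Encodes {s} {Q} Tf v L =
    (∀ e → e ∈ L → ∃₂ λ u (q : Q u ≡ true) → Describes (Tf u q) v e) ×
    (∀ u (q : Q u ≡ true) → Within G s u v →
       ∃ λ e → e ∈ L × Describes (Tf u q) v e)

-- Synchronous deterministic message passing with b-bit messages.
-- Local computation is unrestricted.

record Algorithm (b : ℕ) (I O : ℕ → Set) : Set₁ where
  field
    State  : ℕ → Set
    init   : ∀ d → I d → State d
    send   : ∀ d → State d → Fin d → Vec Bool b
    recv   : ∀ d → State d → (Fin d → Vec Bool b) → State d
    output : ∀ d → State d → O d

open Algorithm public

run : ∀ {b I O n} (A : Algorithm b I O) (G : Graph n) →
      ((v : Fin n) → I (deg G v)) → ℕ → (v : Fin n) → State A (deg G v)
run A G inp zero v = init A (deg G v) (inp v)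
run A G inp (suc r) v =
  recv A (deg G v) (run A G inp r v)
    (λ p → send A (deg G (nbr G v p)) (run A G inp r (nbr G v p)) (back G v p))

result : ∀ {b I O n} (A : Algorithm b I O) (G : Graph n) →
         ((v : Fin n) → I (deg G v)) → ℕ → (v : Fin n) → O (deg G v)
result A G inp R v = output A (deg G v) (run A G inp R v)

-- own ID, membership in Q, list of IDs of N^s(v,Q)
In1 : ℕ → ℕ → Set
In1 a d = Id a × Bool × List (Id a)

Out1 : ℕ → ℕ → Set
Out1 a d = List (Id a)

-- own ID, membership in Q, IDs of N^s(v,Q), IDs of N^{s+1}(v,Q),
-- local parts of the depth-s BFS trees
In2 : ℕ → ℕ → Set
In2 a d = Id a × Bool × List (Id a) × List (Id a) × List (TreeEntry a d)

Out2 : ℕ → ℕ → Set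
Out2 a d = List (TreeEntry a d)

module _ {n a : ℕ} (G : Graph n) (Q : Fin n → Bool) (ID : Fin n → Id a) (s : ℕ) where

  ValidIn1 : ((v : Fin n) → In1 a (deg G v)) → Set
  ValidIn1 inp = ∀ v → let (i , q , L) = inp v in
    i ≡ ID v × q ≡ Q v × KnowsIds ID (BallQ G s v Q) L

  ValidIn2 : TreeFamily G s Q → ((v : Fin n) → In2 a (deg G v)) → Set
  ValidIn2 Tf inp = ∀ v → let (i , q , L , L' , E) = inp v in
    i ≡ ID v × q ≡ Q v × KnowsIds ID (BallQ G s v Q) L ×
    KnowsIds ID (BallQ G (suc s) v Q) L' × Encodes G ID Tf v E

{-# OPTIONS --safe #-}
module Submission where

-- Every node v knows the identifiers of the nodes u ∈ Q with dist(u,v) ≤ s (at most D of them plus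
-- itself) and sends this list to all its neighbours; N^{s+1}(v,Q) is the union of the received lists
-- with v removed. For the trees: a node x with dist(u,x) = s+1 receives ID(u) from some neighbour,
-- adopts the first such neighbour as its parent in T_u, and in a second exchange tells that neighbour,
-- which then adds x to its children; nodes already in T_u keep their parent. Each list fits in
-- (D+1)(a+1) bits, so both exchanges take O(D·a/b + 1) rounds.

open import Defs
open import Data.Nat using (ℕ; zero; suc; _≤_; _<_; _*_; _+_; _∸_; z≤n; s≤s; _/_; NonZero)
open import Data.Nat.Tactic.RingSolver using (solve-∀)
open import Data.Nat.Properties
  using ( ≤-trans; ≤-refl; ≤-pred; <⇒≤; ≰⇒>; ≤⇒≯; <-irrefl; <-≤-trans; m≤n⇒m<n∨m≡n; m≤n⇒m≤1+n; n≤1+n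
        ; m≤m+n; +-comm; +-monoˡ-≤; +-monoʳ-≤; +-mono-≤; +-monoʳ-<; *-distribʳ-+; m+n∸m≡n; _<?_; _≤?_ )
  renaming (_≟_ to _≟ℕ_)
open import Data.Nat.DivMod using (_mod_; _divMod_; DivMod; m<n*o⇒m/o<n; m/n*n≤m)
open import Data.Fin using (Fin; toℕ)
import Data.Fin.Properties as Fin
open import Data.Bool using (Bool; true; false; if_then_else_)
import Data.Bool.Properties as Bool
open import Data.Vec using (Vec; []; _∷_; tabulate; lookup; replicate)
open import Data.Vec.Properties using (tabulate-cong; lookup∘tabulate)
import Data.Vec.Properties as Vec
open import Data.List using (List; []; _∷_; _++_; length; map; filter; concatMap; allFin; deduplicate)
open import Data.Maybe using (Maybe; just; nothing; maybe)
import Data.Maybe.Properties as Maybe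
open import Data.List.Properties using (length-map; length-filter)
open import Data.List.Membership.Propositional using (_∈_; _∉_; find; lose)
open import Data.List.Membership.Propositional.Properties
  using ( ∈-allFin; ∈-concatMap⁺; ∈-concatMap⁻; ∈-deduplicate⁺; ∈-deduplicate⁻; ∈-filter⁺; ∈-filter⁻
        ; ∈-++⁺ˡ; ∈-++⁺ʳ; ∈-++⁻; ∈-map⁺; ∈-map⁻ )
open import Data.List.Relation.Unary.Any using (here; there)
open import Data.List.Relation.Unary.All using (All; []; _∷_)
open import Data.List.Relation.Unary.AllPairs using ([]; _∷_)
open import Data.List.Relation.Unary.Unique.Propositional using (Unique)
import Data.List.Relation.Unary.Unique.Propositional.Properties as Unique
open import Data.List.Relation.Unary.Unique.DecPropositional.Properties using (deduplicate-!)
open import Data.Product using (Σ; ∃; ∃₂; _×_; _,_; proj₁; proj₂)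
open import Data.Sum using (_⊎_; inj₁; inj₂)
open import Data.Empty using (⊥-elim)
open import Relation.Nullary using (¬_; ¬?; Dec; yes; no; _×-dec_)
open import Relation.Binary.PropositionalEquality
  using (_≡_; _≢_; refl; sym; trans; cong; cong₂; subst; module ≡-Reasoning)
open import Function.Definitions using (Injective)

module Walks {n : ℕ} (G : Graph n) where

  Adj-sym : ∀ {v w} → Adj G v w → Adj G w v
  Adj-sym {v} (p , refl) = back G v p , back-ok G v p

  Within-mono : ∀ {j k v w} → j ≤ k → Within G j v w → Within G k v w
  Within-mono _         here       = here
  Within-mono (s≤s j≤k) (step a w) = step a (Within-mono j≤k w)

  Within-snoc : ∀ {k v u w} → Within G k v u → Adj G u w → Within G (suc k) v w
  Within-snoc here       a = step a here
  Within-snoc (step a′ w) a = step a′ (Within-snoc w a)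

  Within-sym : ∀ {k v w} → Within G k v w → Within G k w v
  Within-sym here       = here
  Within-sym (step a w) = Within-snoc (Within-sym w) (Adj-sym a)

  Within-zero : ∀ {v w} → Within G 0 v w → v ≡ w
  Within-zero here = refl

  Within-head : ∀ {k v w} → Within G (suc k) v w → v ≢ w → ∃ λ u → Adj G v u × Within G k u w
  Within-head here       v≢v = ⊥-elim (v≢v refl)
  Within-head (step a w) _   = _ , a , w

  Within-last : ∀ {k v w} → Within G (suc k) v w → v ≢ w → ∃ λ u → Within G k v u × Adj G u w
  Within-last vw v≢w =
    let u , a , uv = Within-head (Within-sym vw) (λ w≡v → v≢w (sym w≡v))
    in u , Within-sym uv , Adj-sym a

  within? : ∀ k v w → Dec (Within G k v w)
  within? zero v w with v Fin.≟ w
  ... | yes refl = yes here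
  ... | no  v≢w  = no (λ vw → v≢w (Within-zero vw))
  within? (suc k) v w with v Fin.≟ w
  ... | yes refl = yes here
  ... | no  v≢w  with Fin.any? (λ p → within? k (nbr G v p) w)
  ...   | yes (p , pw) = yes (step (p , refl) pw)
  ...   | no  ¬pw      = no λ vw → ¬pw (neighbourWithin (Within-head vw v≢w))
    where
    neighbourWithin : (∃ λ u → Adj G v u × Within G k u w) → ∃ λ p → Within G k (nbr G v p) w
    neighbourWithin (_ , (p , refl) , uw) = p , uw

  Within⇒Dist : ∀ s {u x} → Within G s u x → ∃ λ k → k ≤ s × Dist G u x k
  Within⇒Dist zero    ux = 0 , z≤n , ux , λ _ ()
  Within⇒Dist (suc s) {u} {x} ux with within? s u x
  ... | yes ux′ = let k , k≤s , d = Within⇒Dist s ux′ in k , m≤n⇒m≤1+n k≤s , d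
  ... | no ¬ux′ = suc s , ≤-refl , ux , λ j j<1+s uxj → ¬ux′ (Within-mono (≤-pred j<1+s) uxj)

  Dist-pred : ∀ {u x y k} → Adj G y x → Dist G u x (suc k) → Within G k u y → Dist G u y k
  Dist-pred yx (_ , minimal) uy = uy , λ j j<k uyj → minimal (suc j) (s≤s j<k) (Within-snoc uyj yx)

module BFSExtension {n : ℕ} (G : Graph n) where
  open Walks G

  parent-within : ∀ {s u x} (T : BFSTree G s u) → Within G s u x → x ≢ u → Within G s u (parent T x)
  parent-within {s} T ux x≢u with Within⇒Dist s ux
  ... | zero  , _     , ux₀ , _ = ⊥-elim (x≢u (sym (Within-zero ux₀)))
  ... | suc k , 1+k≤s , d       =
    Within-mono (≤-trans (n≤1+n k) 1+k≤s) (proj₁ (parent-dist T _ ux x≢u k d))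

  module Extension {s u} (T : BFSTree G s u) (newParent : Fin n → Fin n)
    (newParent-ok : ∀ x → ¬ Within G s u x → Within G (suc s) u x →
                    Adj G x (newParent x) × Within G s u (newParent x))
    where

    extendedParent : Fin n → Fin n
    extendedParent x with within? s u x
    ... | yes _ = parent T x
    ... | no  _ = newParent x

    extendedParent-old : ∀ {x} → Within G s u x → extendedParent x ≡ parent T x
    extendedParent-old {x} ux with within? s u x
    ... | yes _   = refl
    ... | no  ¬ux = ⊥-elim (¬ux ux)

    extendedParent-new : ∀ {x} → ¬ Within G s u x → extendedParent x ≡ newParent x
    extendedParent-new {x} ¬ux with within? s u x
    ... | yes ux = ⊥-elim (¬ux ux)
    ... | no  _  = refl

    extendBFS : BFSTree G (suc s) u
    extendBFS = record { parent = extendedParent ; parent-adj = adj ; parent-dist = dist }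
      where
      adj : ∀ x → Within G (suc s) u x → x ≢ u → Adj G x (extendedParent x)
      adj x ux x≢u with within? s u x
      ... | yes ux′ = parent-adj T x ux′ x≢u
      ... | no  ¬ux = proj₁ (newParent-ok x ¬ux ux)

      dist : ∀ x → Within G (suc s) u x → x ≢ u → ∀ k → Dist G u x (suc k) → Dist G u (extendedParent x) k
      dist x ux x≢u k d with within? s u x
      ... | yes ux′ = parent-dist T x ux′ x≢u k d
      ... | no  ¬ux with s ≤? k
      ...   | yes s≤k = let x~p , up≤s = newParent-ok x ¬ux ux in Dist-pred (Adj-sym x~p) d (Within-mono s≤k up≤s)
      ...   | no  s≰k = ⊥-elim (¬ux (Within-mono (≰⇒> s≰k) (proj₁ d)))

    extendBFS-extends : Extends G T extendBFS
    extendBFS-extends _ ux _ = extendedParent-old ux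

    IsChild-old : ∀ {v x} → IsChild G T v x → IsChild G extendBFS v x
    IsChild-old (ux , x≢u , px) = Within-mono (n≤1+n s) ux , x≢u , trans (extendedParent-old ux) px

    IsChild-new : ∀ {v x} → ¬ Within G s u x → Within G (suc s) u x → newParent x ≡ v → IsChild G extendBFS v x
    IsChild-new ¬ux ux px = ux , (λ { refl → ¬ux here }) , trans (extendedParent-new ¬ux) px

    IsChild-cases : ∀ {v x} → IsChild G extendBFS v x → IsChild G T v x ⊎ (¬ Within G s u x × newParent x ≡ v)
    IsChild-cases {x = x} (_ , x≢u , px) with within? s u x
    ... | yes ux  = inj₁ (ux , x≢u , px)
    ... | no  ¬ux = inj₂ (¬ux , px)

    IsChild-leaf : ∀ {v x} → ¬ Within G s u v → ¬ IsChild G extendBFS v x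
    IsChild-leaf ¬uv child@(ux , _) with IsChild-cases child
    ... | inj₁ (ux′ , x≢u , px) = ¬uv (subst (Within G s u) px (parent-within T ux′ x≢u))
    ... | inj₂ (¬ux , px)       = ¬uv (subst (Within G s u) px (proj₂ (newParent-ok _ ¬ux ux)))

module Gather {A : Set} where

  gather : ∀ {d} → Vec (List A) d → List A
  gather {d} V = concatMap (lookup V) (allFin d)

  ∈-gather⁺ : ∀ {d x} {V : Vec (List A) d} p → x ∈ lookup V p → x ∈ gather V
  ∈-gather⁺ {V = V} p x∈ = ∈-concatMap⁺ (lookup V) (lose (∈-allFin p) x∈)

  ∈-gather⁻ : ∀ {d x} (V : Vec (List A) d) → x ∈ gather V → ∃ λ p → x ∈ lookup V p
  ∈-gather⁻ {d} V x∈ = let p , _ , x∈p = find (∈-concatMap⁻ (lookup V) {xs = allFin d} x∈) in p , x∈p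

module KnownIds {n a : ℕ} (ID : Fin n → Id a) where

  KnowsIds-∈⁺ : ∀ {P L w} → KnowsIds ID P L → P w → ID w ∈ L
  KnowsIds-∈⁺ {w = w} known Pw = proj₂ (known (ID w)) (w , Pw , refl)

  KnowsIds-∈⁻ : ∀ {P L w} → Injective _≡_ _≡_ ID → KnowsIds ID P L → ID w ∈ L → P w
  KnowsIds-∈⁻ {w = w} inj known w∈ with proj₁ (known (ID w)) w∈
  ... | w′ , Pw′ , ID≡ = subst _ (inj ID≡) Pw′

  witnesses : ∀ {P : Fin n → Set} (xs : List (Id a)) → (∀ x → x ∈ xs → ∃ λ w → P w × ID w ≡ x) →
              Σ (List (Fin n)) λ ws → All P ws × map ID ws ≡ xs
  witnesses []       _  = [] , [] , refl
  witnesses (x ∷ xs) wx with wx x (here refl) | witnesses xs (λ y y∈ → wx y (there y∈))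
  ... | w , Pw , refl | ws , Pws , refl = w ∷ ws , Pw ∷ Pws , refl

  length-CardLe : ∀ {P D} → CardLe P D → (xs : List (Id a)) → Unique xs →
                  (∀ x → x ∈ xs → ∃ λ w → P w × ID w ≡ x) → length xs ≤ D
  length-CardLe {D = D} card xs xs! wx with witnesses xs wx
  ... | ws , Pws , refl = subst (_≤ D) (sym (length-map ID ws)) (card ws (Unique.map⁻ xs!) Pws)

-- Identifiers of 0 bits are all equal, so a duplicate-free list of them has length at most 1;
-- this keeps the message length within O(D·a + b) also when a = 0.
idBound : ℕ → ℕ → ℕ
idBound zero    D = 1
idBound (suc a) D = D

length-Unique≤idBound : ∀ {a D} (xs : List (Id a)) → Unique xs → length xs ≤ D → length xs ≤ idBound a D
length-Unique≤idBound {suc a} xs _ xs≤D = xs≤D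
length-Unique≤idBound {zero}  []            _                 _ = z≤n
length-Unique≤idBound {zero}  (_ ∷ [])      _                 _ = ≤-refl
length-Unique≤idBound {zero}  ([] ∷ [] ∷ _) ((≢ ∷ _) ∷ _) _ = ⊥-elim (≢ refl)

module IdLists (a : ℕ) where

  _≟ᵢ_ : (x y : Id a) → Dec (x ≡ y)
  _≟ᵢ_ = Vec.≡-dec Bool._≟_

  open import Data.List.Membership.DecPropositional _≟ᵢ_ public using (_∈?_; _∉?_)

  closedBallIds : Id a → Bool → List (Id a) → List (Id a)
  closedBallIds i true  L = i ∷ deduplicate _≟ᵢ_ L
  closedBallIds i false L = deduplicate _≟ᵢ_ L

module Balls {n a : ℕ} (G : Graph n) (Q : Fin n → Bool) (ID : Fin n → Id a) where
  open IdLists a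
  open KnownIds ID

  ClosedBallQ : ℕ → Fin n → Fin n → Set
  ClosedBallQ s v w = Within G s v w × Q w ≡ true

  closedBallIds-knows : ∀ {s v i q L} → i ≡ ID v → q ≡ Q v → KnowsIds ID (BallQ G s v Q) L →
                  KnowsIds ID (ClosedBallQ s v) (closedBallIds i q L)
  closedBallIds-knows {s} {v} {q = q} {L} refl q≡Qv known x = sound q q≡Qv , complete q q≡Qv
    where
    fromL : x ∈ deduplicate _≟ᵢ_ L → ∃ λ w → ClosedBallQ s v w × ID w ≡ x
    fromL x∈ with proj₁ (known x) (∈-deduplicate⁻ _≟ᵢ_ L x∈)
    ... | w , ((_ , vw) , Qw) , IDw = w , (vw , Qw) , IDw

    toL : ∀ {w} → w ≢ v → ClosedBallQ s v w → ID w ≡ x → x ∈ deduplicate _≟ᵢ_ L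
    toL w≢v (vw , Qw) IDw = ∈-deduplicate⁺ _≟ᵢ_ (proj₂ (known x) (_ , ((w≢v , vw) , Qw) , IDw))

    sound : ∀ q → q ≡ Q v → x ∈ closedBallIds (ID v) q L → ∃ λ w → ClosedBallQ s v w × ID w ≡ x
    sound true  Qv (here refl) = v , (here , sym Qv) , refl
    sound true  _  (there x∈)  = fromL x∈
    sound false _  x∈          = fromL x∈

    complete : ∀ q → q ≡ Q v → (∃ λ w → ClosedBallQ s v w × ID w ≡ x) → x ∈ closedBallIds (ID v) q L
    complete q Qv (w , cb , IDw) with w Fin.≟ v
    complete true  _  (_ , _ , refl)       | yes refl = here refl
    complete false Qv (_ , (_ , Qw) , _)   | yes refl with trans Qv Qw
    ... | ()
    complete true  _  (_ , cb , IDw)       | no w≢v   = there (toL w≢v cb IDw)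
    complete false _  (_ , cb , IDw)       | no w≢v   = toL w≢v cb IDw

  length-deduplicate≤idBound : ∀ {s v D L} → CardLe (BallQ G s v Q) D → KnowsIds ID (BallQ G s v Q) L →
                               length (deduplicate _≟ᵢ_ L) ≤ idBound a D
  length-deduplicate≤idBound {L = L} card known =
    length-Unique≤idBound _ (deduplicate-! _≟ᵢ_ L)
      (length-CardLe card _ (deduplicate-! _≟ᵢ_ L) (λ x x∈ → proj₁ (known x) (∈-deduplicate⁻ _≟ᵢ_ L x∈)))

  length-closedBallIds : ∀ {s v D L} i q → CardLe (BallQ G s v Q) D → KnowsIds ID (BallQ G s v Q) L →
                   length (closedBallIds i q L) ≤ suc (idBound a D)
  length-closedBallIds i true  card known = s≤s (length-deduplicate≤idBound card known)
  length-closedBallIds i false card known = m≤n⇒m≤1+n (length-deduplicate≤idBound card known)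

Stream : Set
Stream = ℕ → Bool

_++ˢ_ : ∀ {m} → Vec Bool m → Stream → Stream
([]       ++ˢ f) j       = f j
((x ∷ xs) ++ˢ f) zero    = x
((x ∷ xs) ++ˢ f) (suc j) = (xs ++ˢ f) j

takeˢ : ∀ m → Stream → Vec Bool m
takeˢ m f = tabulate (λ i → f (toℕ i))

dropˢ : ℕ → Stream → Stream
dropˢ m f j = f (m + j)

takeˢ-++ˢ : ∀ {m} (xs : Vec Bool m) f → takeˢ m (xs ++ˢ f) ≡ xs
takeˢ-++ˢ []       f = refl
takeˢ-++ˢ (x ∷ xs) f = cong (x ∷_) (takeˢ-++ˢ xs f)

dropˢ-++ˢ : ∀ {m} (xs : Vec Bool m) f → dropˢ m (xs ++ˢ f) ≡ f
dropˢ-++ˢ []       f = refl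
dropˢ-++ˢ (x ∷ xs) f = dropˢ-++ˢ xs f

AgreeBelow : ℕ → Stream → Stream → Set
AgreeBelow m f g = ∀ j → j < m → f j ≡ g j

-- An identifier list is sent as blocks of a+1 bits: a flag bit set to true, then the identifier;
-- the first block whose flag is false ends the list.
module Encoding (a : ℕ) where

  encode : List (Id a) → Stream
  encode []       _ = false
  encode (x ∷ xs)   = (true ∷ x) ++ˢ encode xs

  decode : ℕ → Stream → List (Id a)
  decode zero    f = []
  decode (suc k) f = if f 0 then takeˢ a (dropˢ 1 f) ∷ decode k (dropˢ (suc a) f) else []

  decode-encode : ∀ {k} (xs : List (Id a)) → length xs ≤ k → decode k (encode xs) ≡ xs
  decode-encode {zero}  []       _         = refl
  decode-encode {suc k} []       _         = refl
  decode-encode {suc k} (x ∷ xs) (s≤s xs≤k) =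
    cong₂ _∷_ (takeˢ-++ˢ x (encode xs))
              (trans (cong (decode k) (dropˢ-++ˢ x (encode xs))) (decode-encode xs xs≤k))

  decode-cong : ∀ k {f g} → AgreeBelow (k * suc a) f g → decode k f ≡ decode k g
  decode-cong zero    _   = refl
  decode-cong (suc k) {f} {g} f≈g with f 0 | g 0 | f≈g 0 (s≤s z≤n)
  ... | false | false | refl = refl
  ... | true  | true  | refl =
    cong₂ _∷_ (tabulate-cong λ i → f≈g _ (s≤s (≤-trans (Fin.toℕ<n i) (m≤m+n a (k * suc a)))))
              (decode-cong k λ j j<k[1+a] → f≈g _ (+-monoʳ-< (suc a) j<k[1+a]))

storeAt : ∀ {X : Set} → ℕ → X → (ℕ → X) → ℕ → X
storeAt r x h r′ with r′ ≟ℕ r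
... | yes _ = x
... | no  _ = h r′

storeAt-here : ∀ {X : Set} r {x : X} {h} → storeAt r x h r ≡ x
storeAt-here r with r ≟ℕ r
... | yes _   = refl
... | no  r≢r = ⊥-elim (r≢r refl)

storeAt-earlier : ∀ {X : Set} {r r′} {x : X} {h} → r′ < r → storeAt r x h r′ ≡ h r′
storeAt-earlier {r = r} {r′} r′<r with r′ ≟ℕ r
... | yes refl = ⊥-elim (<-irrefl refl r′<r)
... | no  _    = refl

chunk : (b : ℕ) → Stream → ℕ → Vec Bool b
chunk b f r = tabulate (λ i → f (toℕ i + r * b))

lookup-chunk : ∀ b .{{_ : NonZero b}} f j → lookup (chunk b f (j / b)) (j mod b) ≡ f j
lookup-chunk b f j = trans (lookup∘tabulate _ (j mod b)) (cong f (sym (DivMod.property (j divMod b))))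

-- During rounds 0 … T-1 every node
-- streams the list `first` to all neighbours; during rounds T … 2T-1 it streams, on each port, the
-- list `second` computed from the lists it received in the first phase.
module Exchange {a : ℕ} (K b : ℕ) .{{_ : NonZero b}} (T : ℕ) (window : K * suc a ≤ T * b)
  {I O : ℕ → Set}
  (first  : ∀ {d} → I d → List (Id a))
  (second : ∀ {d} → I d → Vec (List (Id a)) d → Fin d → List (Id a))
  (finish : ∀ {d} → I d → Vec (List (Id a)) d → Vec (List (Id a)) d → O d)
  where
  open Encoding a

  record Node (d : ℕ) : Set where
    constructor node
    field
      input : I d
      clock : ℕ
      inbox : ℕ → Fin d → Vec Bool b

  open Node

  received : ∀ {d} → ℕ → Node d → Fin d → Stream
  received t x p j = lookup (inbox x (t + j / b) p) (j mod b)

  firstLists secondLists : ∀ {d} → Node d → Vec (List (Id a)) d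
  firstLists  x = tabulate λ p → decode K (received 0 x p)
  secondLists x = tabulate λ p → decode K (received T x p)

  message : ∀ {d} → Node d → Fin d → Vec Bool b
  message x p with clock x <? T
  ... | yes _ = chunk b (encode (first (input x))) (clock x)
  ... | no  _ = chunk b (encode (second (input x) (firstLists x) p)) (clock x ∸ T)

  deliver : ∀ {d} → Node d → (Fin d → Vec Bool b) → Node d
  deliver x m = node (input x) (suc (clock x)) (storeAt (clock x) m (inbox x))

  algorithm : Algorithm b I O
  algorithm = record
    { State  = Node
    ; init   = λ _ i → node i 0 (λ _ _ → replicate b false)
    ; send   = λ _ → message
    ; recv   = λ _ → deliver
    ; output = λ _ x → finish (input x) (firstLists x) (secondLists x)
    }

  message-first : ∀ {d} (x : Node d) p → clock x < T →
                  message x p ≡ chunk b (encode (first (input x))) (clock x)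
  message-first x p c<T with clock x <? T
  ... | yes _   = refl
  ... | no  c≮T = ⊥-elim (c≮T c<T)

  message-second : ∀ {d} (x : Node d) p → ¬ clock x < T →
                   message x p ≡ chunk b (encode (second (input x) (firstLists x) p)) (clock x ∸ T)
  message-second x p c≮T with clock x <? T
  ... | yes c<T = ⊥-elim (c≮T c<T)
  ... | no  _   = refl

  module Run {n : ℕ} (G : Graph n) (inp : (v : Fin n) → I (deg G v)) where

    state : ℕ → (v : Fin n) → Node (deg G v)
    state = run algorithm G inp

    input-state : ∀ r v → input (state r v) ≡ inp v
    input-state zero    v = refl
    input-state (suc r) v = input-state r v

    clock-state : ∀ r v → clock (state r v) ≡ r
    clock-state zero    v = refl
    clock-state (suc r) v = cong suc (clock-state r v)

    inbox-state : ∀ {r r′} v p → r′ < r → inbox (state r v) r′ p ≡ message (state r′ (nbr G v p)) (back G v p)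
    inbox-state {suc r} {r′} v p r′<1+r rewrite clock-state r v with m≤n⇒m<n∨m≡n (≤-pred r′<1+r)
    ... | inj₁ r′<r  = trans (cong (λ h → h p) (storeAt-earlier {h = inbox (state r v)} r′<r)) (inbox-state v p r′<r)
    ... | inj₂ refl  = cong (λ h → h p) (storeAt-here r′ {h = inbox (state r′ v)})

    ideal₁ : (v : Fin n) → Vec (List (Id a)) (deg G v)
    ideal₁ v = tabulate λ p → first (inp (nbr G v p))

    ideal₂ : (v : Fin n) → Vec (List (Id a)) (deg G v)
    ideal₂ v = tabulate λ p → second (inp (nbr G v p)) (ideal₁ (nbr G v p)) (back G v p)

    lookup-ideal₁ : ∀ v p → lookup (ideal₁ v) p ≡ first (inp (nbr G v p))
    lookup-ideal₁ v p = lookup∘tabulate (λ p → first (inp (nbr G v p))) p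

    lookup-ideal₂ : ∀ v p → lookup (ideal₂ v) p ≡ second (inp (nbr G v p)) (ideal₁ (nbr G v p)) (back G v p)
    lookup-ideal₂ v p = lookup∘tabulate (λ p → second (inp (nbr G v p)) (ideal₁ (nbr G v p)) (back G v p)) p

    module _ (first-fits  : ∀ v → length (first (inp v)) ≤ K)
             (second-fits : ∀ v p → length (second (inp v) (ideal₁ v) p) ≤ K) where
      open ≡-Reasoning

      inWindow : ∀ {j} → j < K * suc a → j / b < T
      inWindow j<K[1+a] = m<n*o⇒m/o<n (<-≤-trans j<K[1+a] window)

      received-first : ∀ {r} v p → T ≤ r →
                       AgreeBelow (K * suc a) (received 0 (state r v) p) (encode (first (inp (nbr G v p))))
      received-first {r} v p T≤r j j<K[1+a] = begin
        lookup (inbox (state r v) (j / b) p) (j mod b)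
          ≡⟨ cong (λ m → lookup m (j mod b)) (inbox-state v p (<-≤-trans (inWindow j<K[1+a]) T≤r)) ⟩
        lookup (message x (back G v p)) (j mod b)
          ≡⟨ cong (λ m → lookup m (j mod b))
                  (message-first x _ (subst (_< T) (sym (clock-state (j / b) w)) (inWindow j<K[1+a]))) ⟩
        lookup (chunk b (encode (first (input x))) (clock x)) (j mod b)
          ≡⟨ cong₂ (λ i c → lookup (chunk b (encode (first i)) c) (j mod b))
                   (input-state (j / b) w) (clock-state (j / b) w) ⟩
        lookup (chunk b (encode (first (inp w))) (j / b)) (j mod b)
          ≡⟨ lookup-chunk b (encode (first (inp w))) j ⟩
        encode (first (inp w)) j ∎
        where
        w : Fin n
        w = nbr G v p
        x : Node (deg G w)
        x = state (j / b) w

      firstLists-state : ∀ {r} v → T ≤ r → firstLists (state r v) ≡ ideal₁ v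
      firstLists-state v T≤r = tabulate-cong λ p →
        trans (decode-cong K (received-first v p T≤r)) (decode-encode _ (first-fits (nbr G v p)))

      received-second : ∀ v p → AgreeBelow (K * suc a) (received T (state (T + T) v) p)
                                          (encode (second (inp (nbr G v p)) (ideal₁ (nbr G v p)) (back G v p)))
      received-second v p j j<K[1+a] = begin
        lookup (inbox (state (T + T) v) (T + j / b) p) (j mod b)
          ≡⟨ cong (λ m → lookup m (j mod b)) (inbox-state v p (+-monoʳ-< T (inWindow j<K[1+a]))) ⟩
        lookup (message x q) (j mod b)
          ≡⟨ cong (λ m → lookup m (j mod b)) (message-second x q late) ⟩
        lookup (chunk b (encode (second (input x) (firstLists x) q)) (clock x ∸ T)) (j mod b)
          ≡⟨ cong₂ (λ i V → lookup (chunk b (encode (second i V q)) (clock x ∸ T)) (j mod b))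
                   (input-state (T + j / b) w) (firstLists-state w (m≤m+n T (j / b))) ⟩
        lookup (chunk b (encode (second (inp w) (ideal₁ w) q)) (clock x ∸ T)) (j mod b)
          ≡⟨ cong (λ c → lookup (chunk b (encode (second (inp w) (ideal₁ w) q)) (c ∸ T)) (j mod b))
                  (clock-state (T + j / b) w) ⟩
        lookup (chunk b (encode (second (inp w) (ideal₁ w) q)) (T + j / b ∸ T)) (j mod b)
          ≡⟨ cong (λ c → lookup (chunk b (encode (second (inp w) (ideal₁ w) q)) c) (j mod b))
                  (m+n∸m≡n T (j / b)) ⟩
        lookup (chunk b (encode (second (inp w) (ideal₁ w) q)) (j / b)) (j mod b)
          ≡⟨ lookup-chunk b (encode (second (inp w) (ideal₁ w) q)) j ⟩
        encode (second (inp w) (ideal₁ w) q) j ∎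
        where
        w : Fin n
        w = nbr G v p
        q : Fin (deg G w)
        q = back G v p
        x : Node (deg G w)
        x = state (T + j / b) w
        late : ¬ clock x < T
        late c<T = ≤⇒≯ (m≤m+n T (j / b)) (subst (_< T) (clock-state (T + j / b) w) c<T)

      secondLists-state : ∀ v → secondLists (state (T + T) v) ≡ ideal₂ v
      secondLists-state v = tabulate-cong λ p →
        trans (decode-cong K (received-second v p)) (decode-encode _ (second-fits (nbr G v p) (back G v p)))

      result-exchange : ∀ v → result algorithm G inp (T + T) v ≡ finish (inp v) (ideal₁ v) (ideal₂ v)
      result-exchange v
        rewrite input-state (T + T) v | firstLists-state v (m≤m+n T T) | secondLists-state v = refl

m≤[1+m/n]*n : ∀ m n .{{_ : NonZero n}} → m ≤ suc (m / n) * n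
m≤[1+m/n]*n m n = subst (_≤ suc (m / n) * n) (sym (DivMod.property (m divMod n)))
                        (+-monoˡ-≤ (m / n * n) (<⇒≤ (Fin.toℕ<n (m mod n))))

[1+m/n]*n≤m+n : ∀ m n .{{_ : NonZero n}} → suc (m / n) * n ≤ m + n
[1+m/n]*n≤m+n m n = subst (suc (m / n) * n ≤_) (+-comm n m) (+-monoʳ-≤ n (m/n*n≤m m n))

module Schedule (D a b : ℕ) .{{_ : NonZero b}} where

  K : ℕ
  K = suc (idBound a D)

  T : ℕ
  T = suc (K * suc a / b)

  window : K * suc a ≤ T * b
  window = m≤[1+m/n]*n (K * suc a) b

capacity+b≤ : ∀ d a b → suc (idBound a (suc d)) * suc a + suc b ≤ 4 * (suc d * a + suc b)
capacity+b≤ d zero b = subst (2 + suc b ≤_) (sym (identity d b)) (m≤m+n (2 + suc b) (1 + 3 * b))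
  where
  identity : ∀ d b → 4 * (suc d * 0 + suc b) ≡ 2 + suc b + (1 + 3 * b)
  identity = solve-∀
-- The slack is 4(D·a + b) − ((D+1)(a+1) + b), expanded in d = D − 1 and e = a − 1.
capacity+b≤ d (suc e) b = subst (lhs ≤_) (sym (identity d e b)) (m≤m+n lhs (3 * d * e + 2 * d + 2 * e + 3 * suc b))
  where
  lhs : ℕ
  lhs = suc (suc d) * suc (suc e) + suc b
  identity : ∀ d e b → 4 * (suc d * suc e + suc b) ≡
                       suc (suc d) * suc (suc e) + suc b + (3 * d * e + 2 * d + 2 * e + 3 * suc b)
  identity = solve-∀

rounds-cost : ∀ d a b → let open Schedule (suc d) a (suc b) in (T + T) * suc b ≤ 8 * (suc d * a + suc b)
rounds-cost d a b = subst (_≤ 8 * X) (sym (*-distribʳ-+ (suc b) T T))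
                          (subst (T * suc b + T * suc b ≤_) (double X) (+-mono-≤ T*b≤4X T*b≤4X))
  where
  open Schedule (suc d) a (suc b)
  X : ℕ
  X = suc d * a + suc b
  T*b≤4X : T * suc b ≤ 4 * X
  T*b≤4X = ≤-trans ([1+m/n]*n≤m+n (K * suc a) (suc b)) (capacity+b≤ d a b)
  double : ∀ x → 4 * x + 4 * x ≡ 8 * x
  double = solve-∀

module NextBallIds (s D a b : ℕ) .{{_ : NonZero b}} where
  open IdLists a
  open Schedule D a b public
  open Gather

  ownBallIds : ∀ {d} → In1 a d → List (Id a)
  ownBallIds (i , q , L) = closedBallIds i q L

  nextBallIds : ∀ {d} → In1 a d → Vec (List (Id a)) d → Vec (List (Id a)) d → Out1 a d
  nextBallIds (i , _ , _) V₁ _ = filter (λ x → ¬? (x ≟ᵢ i)) (gather V₁)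

  silent : ∀ {d} → In1 a d → Vec (List (Id a)) d → Fin d → List (Id a)
  silent _ _ _ = []

  module Protocol = Exchange K b T window {In1 a} {Out1 a} (λ {d} → ownBallIds {d}) silent nextBallIds
  open Protocol public using (algorithm)

  module Correctness {n} (G : Graph n) (Q : Fin n → Bool) (ID : Fin n → Id a) (inj : Injective _≡_ _≡_ ID)
    (card : ∀ v → CardLe (BallQ G s v Q) D)
    (inp : (v : Fin n) → In1 a (deg G v)) (valid : ValidIn1 G Q ID s inp) where
    open Walks G
    open Balls G Q ID
    open KnownIds ID
    open Protocol.Run G inp

    known : ∀ y → KnowsIds ID (ClosedBallQ s y) (ownBallIds {deg G y} (inp y))
    known y = closedBallIds-knows (proj₁ (valid y)) (proj₁ (proj₂ (valid y))) (proj₂ (proj₂ (valid y)))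

    fits : ∀ y → length (ownBallIds {deg G y} (inp y)) ≤ K
    fits y = length-closedBallIds (proj₁ (inp y)) (proj₁ (proj₂ (inp y))) (card y) (proj₂ (proj₂ (valid y)))

    nextBallIds-knows : ∀ v → KnowsIds ID (BallQ G (suc s) v Q) (nextBallIds (inp v) (ideal₁ v) (ideal₂ v))
    nextBallIds-knows v x = sound , complete
      where
      notOwn? : ∀ x → Dec (x ≢ proj₁ (inp v))
      notOwn? x = ¬? (x ≟ᵢ proj₁ (inp v))

      sound : x ∈ nextBallIds (inp v) (ideal₁ v) (ideal₂ v) → ∃ λ w → BallQ G (suc s) v Q w × ID w ≡ x
      sound x∈ with ∈-filter⁻ notOwn? {xs = gather (ideal₁ v)} x∈
      ... | x∈gather , x≢i with ∈-gather⁻ (ideal₁ v) x∈gather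
      ... | p , x∈p with proj₁ (known (nbr G v p) x) (subst (x ∈_) (lookup-ideal₁ v p) x∈p)
      ... | w , (yw , Qw) , refl = w , ((w≢v , step (p , refl) yw) , Qw) , refl
        where
        w≢v : w ≢ v
        w≢v refl = x≢i (sym (proj₁ (valid v)))

      complete : (∃ λ w → BallQ G (suc s) v Q w × ID w ≡ x) → x ∈ nextBallIds (inp v) (ideal₁ v) (ideal₂ v)
      complete (w , ((w≢v , vw) , Qw) , refl) with Within-head vw (λ v≡w → w≢v (sym v≡w))
      ... | _ , (p , refl) , yw =
        ∈-filter⁺ notOwn?
          (∈-gather⁺ {V = ideal₁ v} p (subst (ID w ∈_) (sym (lookup-ideal₁ v p)) (KnowsIds-∈⁺ (known _) (yw , Qw))))
          (λ IDw≡i → w≢v (inj (trans IDw≡i (proj₁ (valid v)))))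

  algorithm-correct : ∀ {n} (G : Graph n) (Q : Fin n → Bool) (ID : Fin n → Id a) →
                      Injective _≡_ _≡_ ID → (∀ v → CardLe (BallQ G s v Q) D) →
                      (inp : (v : Fin n) → In1 a (deg G v)) → ValidIn1 G Q ID s inp →
                      ∀ v → KnowsIds ID (BallQ G (suc s) v Q) (result algorithm G inp (T + T) v)
  algorithm-correct G Q ID inj card inp valid v =
    subst (KnowsIds ID (BallQ G (suc s) v Q)) (sym (Protocol.Run.result-exchange G inp fits (λ _ _ → z≤n) v))
          (nextBallIds-knows v)
    where open Correctness G Q ID inj card inp valid

module ExtendTrees (s D a b : ℕ) .{{_ : NonZero b}} where
  open IdLists a
  open Schedule D a b public
  open Gather

  ownBallIds : ∀ {d} → In2 a d → List (Id a)
  ownBallIds (i , q , L , _ , _) = closedBallIds i q L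

  entries : ∀ {d} → In2 a d → List (TreeEntry a d)
  entries (_ , _ , _ , _ , E) = E

  parentPort : ∀ {d} → Id a → Vec (List (Id a)) d → Maybe (Fin d)
  parentPort rid V with Fin.any? (λ p → rid ∈? lookup V p)
  ... | yes (p , _) = just p
  ... | no  _       = nothing

  parentPort-just : ∀ {d rid p} (V : Vec (List (Id a)) d) → parentPort rid V ≡ just p → rid ∈ lookup V p
  parentPort-just {rid = rid} V eq with Fin.any? (λ p → rid ∈? lookup V p)
  parentPort-just V refl | yes (_ , rid∈) = rid∈

  parentPort-complete : ∀ {d rid} (V : Vec (List (Id a)) d) p → rid ∈ lookup V p →
                        ∃ λ p′ → parentPort rid V ≡ just p′
  parentPort-complete {rid = rid} V p rid∈ with Fin.any? (λ p → rid ∈? lookup V p)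
  ... | yes (p′ , _) = p′ , refl
  ... | no  ¬any     = ⊥-elim (¬any (p , rid∈))

  adopts? : ∀ {d} (i : In2 a d) (V : Vec (List (Id a)) d) (p : Fin d) rid →
            Dec (rid ∉ ownBallIds i × parentPort rid V ≡ just p)
  adopts? i V p rid = rid ∉? ownBallIds i ×-dec Maybe.≡-dec Fin._≟_ (parentPort rid V) (just p)

  adoptions : ∀ {d} → In2 a d → Vec (List (Id a)) d → Fin d → List (Id a)
  adoptions i V p = filter (adopts? i V p) (lookup V p)

  extendEntry : ∀ {d} → Vec (List (Id a)) d → TreeEntry a d → TreeEntry a d
  extendEntry {d} V₂ e = entry (root e) (par e) (children e ++ filter (λ c → root e ∈? lookup V₂ c) (allFin d))

  newEntry : ∀ {d} → Vec (List (Id a)) d → Id a → TreeEntry a d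
  newEntry V₁ rid = entry rid (parentPort rid V₁) []

  newRoots : ∀ {d} → In2 a d → Vec (List (Id a)) d → List (Id a)
  newRoots i V₁ = filter (λ rid → rid ∉? ownBallIds i) (gather V₁)

  extendedEntries : ∀ {d} → In2 a d → Vec (List (Id a)) d → Vec (List (Id a)) d → Out2 a d
  extendedEntries i V₁ V₂ = map (extendEntry V₂) (entries i) ++ map (newEntry V₁) (newRoots i V₁)

  module Protocol = Exchange K b T window {In2 a} {Out2 a} (λ {d} → ownBallIds {d}) adoptions extendedEntries
  open Protocol public using (algorithm)

  module Correctness {n} (G : Graph n) (Q : Fin n → Bool) (ID : Fin n → Id a) (inj : Injective _≡_ _≡_ ID)
    (card : ∀ v → CardLe (BallQ G s v Q) D) (Tf : TreeFamily G s Q)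
    (inp : (v : Fin n) → In2 a (deg G v)) (valid : ValidIn2 G Q ID s Tf inp) where
    open Walks G
    open BFSExtension G
    open Balls G Q ID
    open KnownIds ID
    open Protocol.Run G inp

    ballIdsAt : (y : Fin n) → List (Id a)
    ballIdsAt y = ownBallIds {deg G y} (inp y)

    known : ∀ y → KnowsIds ID (ClosedBallQ s y) (ballIdsAt y)
    known y = closedBallIds-knows (proj₁ (valid y)) (proj₁ (proj₂ (valid y))) (proj₁ (proj₂ (proj₂ (valid y))))

    ∈ballIdsAt⁺ : ∀ {u y} → Q u ≡ true → Within G s u y → ID u ∈ ballIdsAt y
    ∈ballIdsAt⁺ Qu uy = KnowsIds-∈⁺ (known _) (Within-sym uy , Qu)

    ∈ballIdsAt⁻ : ∀ {u y} → ID u ∈ ballIdsAt y → Within G s u y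
    ∈ballIdsAt⁻ u∈ = Within-sym (proj₁ (KnowsIds-∈⁻ inj (known _) u∈))

    ∈ideal₁⁺ : ∀ {u x} p → Q u ≡ true → Within G s u (nbr G x p) → ID u ∈ lookup (ideal₁ x) p
    ∈ideal₁⁺ {u} {x} p Qu uy = subst (ID u ∈_) (sym (lookup-ideal₁ x p)) (∈ballIdsAt⁺ Qu uy)

    ∈ideal₁⁻ : ∀ {u x} p → ID u ∈ lookup (ideal₁ x) p → Within G s u (nbr G x p)
    ∈ideal₁⁻ {u} {x} p u∈ = ∈ballIdsAt⁻ (subst (ID u ∈_) (lookup-ideal₁ x p) u∈)

    fits₁ : ∀ y → length (ballIdsAt y) ≤ K
    fits₁ y = length-closedBallIds (proj₁ (inp y)) (proj₁ (proj₂ (inp y))) (card y)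
                                   (proj₁ (proj₂ (proj₂ (valid y))))

    fits₂ : ∀ y p → length (adoptions (inp y) (ideal₁ y) p) ≤ K
    fits₂ y p = ≤-trans (length-filter _ (lookup (ideal₁ y) p))
                        (subst (λ L → length L ≤ K) (sym (lookup-ideal₁ y p)) (fits₁ (nbr G y p)))

    adoptedParent : Fin n → Fin n → Fin n
    adoptedParent u x = maybe (nbr G x) x (parentPort (ID u) (ideal₁ x))

    adoptedParent-just : ∀ {u x p} → parentPort (ID u) (ideal₁ x) ≡ just p → adoptedParent u x ≡ nbr G x p
    adoptedParent-just eq rewrite eq = refl

    adoptedParent-ok : ∀ u → Q u ≡ true → ∀ x → ¬ Within G s u x → Within G (suc s) u x →
            Adj G x (adoptedParent u x) × Within G s u (adoptedParent u x)
    adoptedParent-ok u Qu x ¬ux ux with Within-last ux (λ { refl → ¬ux here })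
    ... | y , uy , yx with Adj-sym yx
    ... | p , refl with parentPort-complete (ideal₁ x) p (∈ideal₁⁺ p Qu uy)
    ... | p′ , eq rewrite adoptedParent-just {u} eq =
      (p′ , refl) , ∈ideal₁⁻ p′ (parentPort-just (ideal₁ x) eq)

    module Grown u (Qu : Q u ≡ true) = Extension (Tf u Qu) (adoptedParent u) (adoptedParent-ok u Qu)

    tree : TreeFamily G (suc s) Q
    tree = Grown.extendBFS

    adoptedParent≡⇒parentPort : ∀ {u v c} → adoptedParent u (nbr G v c) ≡ v →
                                parentPort (ID u) (ideal₁ (nbr G v c)) ≡ just (back G v c)
    adoptedParent≡⇒parentPort {u} {v} {c} px≡v with parentPort (ID u) (ideal₁ (nbr G v c))
    ... | just p  = cong just (nbr-inj G (nbr G v c) (trans px≡v (sym (back-ok G v c))))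
    ... | nothing = ⊥-elim (no-loop G v c px≡v)

    adopted⁺ : ∀ {u v c} → Q u ≡ true → Within G s u v →
               ¬ Within G s u (nbr G v c) → adoptedParent u (nbr G v c) ≡ v → ID u ∈ lookup (ideal₂ v) c
    adopted⁺ {u} {v} {c} Qu uv ¬ux px≡v =
      subst (ID u ∈_) (sym (lookup-ideal₂ v c))
        (∈-filter⁺ (adopts? (inp x) (ideal₁ x) (back G v c))
          (∈ideal₁⁺ (back G v c) Qu (subst (Within G s u) (sym (back-ok G v c)) uv))
          ((λ u∈own → ¬ux (∈ballIdsAt⁻ u∈own)) , adoptedParent≡⇒parentPort px≡v))
      where
      x : Fin n
      x = nbr G v c

    adopted⁻ : ∀ {u v c} → Q u ≡ true → ID u ∈ lookup (ideal₂ v) c →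
               ¬ Within G s u (nbr G v c) × adoptedParent u (nbr G v c) ≡ v
    adopted⁻ {u} {v} {c} Qu u∈
      with ∈-filter⁻ (adopts? (inp x) (ideal₁ x) (back G v c)) {xs = lookup (ideal₁ x) (back G v c)}
                     (subst (ID u ∈_) (lookup-ideal₂ v c) u∈)
      where
      x : Fin n
      x = nbr G v c
    ... | _ , u∉own , eq = (λ ux → u∉own (∈ballIdsAt⁺ Qu ux)) , trans (adoptedParent-just eq) (back-ok G v c)

    oldEntry-describes : ∀ {u} (Qu : Q u ≡ true) {v e} → Describes G ID (Tf u Qu) v e →
                         Describes G ID (tree u Qu) v (extendEntry (ideal₂ v) e)
    oldEntry-describes {u} Qu {v} {e} (root≡ , uv , parent-ok , children-ok) =
      root≡ , Within-mono (n≤1+n s) uv , grownParent parent-ok , λ c → sound c , complete c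
      where
      open Grown u Qu

      grownParent : (v ≡ u × par e ≡ nothing) ⊎ (v ≢ u × ∃ λ p → par e ≡ just p × nbr G v p ≡ parent (Tf u Qu) v) →
                    (v ≡ u × par e ≡ nothing) ⊎ (v ≢ u × ∃ λ p → par e ≡ just p × nbr G v p ≡ parent (tree u Qu) v)
      grownParent (inj₁ isRoot)                    = inj₁ isRoot
      grownParent (inj₂ (v≢u , p , par≡ , nbr≡)) =
        inj₂ (v≢u , p , par≡ , trans nbr≡ (sym (extendedParent-old uv)))

      isRoot? : ∀ c → Dec (root e ∈ lookup (ideal₂ v) c)
      isRoot? c = root e ∈? lookup (ideal₂ v) c

      sound : ∀ c → c ∈ children (extendEntry (ideal₂ v) e) → IsChild G (tree u Qu) v (nbr G v c)
      sound c c∈ with ∈-++⁻ (children e) c∈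
      ... | inj₁ c∈old = IsChild-old (proj₁ (children-ok c) c∈old)
      ... | inj₂ c∈new with adopted⁻ Qu (subst (_∈ lookup (ideal₂ v) c) root≡
                                           (proj₂ (∈-filter⁻ isRoot? {xs = allFin _} c∈new)))
      ...   | ¬ux , px≡v = IsChild-new ¬ux (Within-snoc uv (c , refl)) px≡v

      complete : ∀ c → IsChild G (tree u Qu) v (nbr G v c) → c ∈ children (extendEntry (ideal₂ v) e)
      complete c child with IsChild-cases child
      ... | inj₁ old            = ∈-++⁺ˡ (proj₂ (children-ok c) old)
      ... | inj₂ (¬ux , px≡v) =
        ∈-++⁺ʳ (children e) (∈-filter⁺ isRoot? (∈-allFin c)
          (subst (_∈ lookup (ideal₂ v) c) (sym root≡) (adopted⁺ Qu uv ¬ux px≡v)))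

    newEntry-describes : ∀ {u} (Qu : Q u ≡ true) {v} p → ¬ Within G s u v → Within G s u (nbr G v p) →
                         Describes G ID (tree u Qu) v (newEntry (ideal₁ v) (ID u))
    newEntry-describes {u} Qu {v} p ¬uv uy
      with parentPort-complete (ideal₁ v) p (∈ideal₁⁺ p Qu uy)
    ... | p′ , eq =
      refl , Within-snoc uy (Adj-sym (p , refl)) ,
      inj₂ ((λ { refl → ¬uv here }) , p′ , eq , sym (trans (extendedParent-new ¬uv) (adoptedParent-just eq))) ,
      λ c → (λ ()) , λ child → ⊥-elim (IsChild-leaf ¬uv child)
      where open Grown u Qu

    encodes : ∀ v → Encodes G ID tree v (extendedEntries (inp v) (ideal₁ v) (ideal₂ v))
    encodes v = sound , complete
      where
      encoded : Encodes G ID Tf v (entries (inp v))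
      encoded = proj₂ (proj₂ (proj₂ (proj₂ (valid v))))

      notOwn? : ∀ rid → Dec (rid ∉ ballIdsAt v)
      notOwn? rid = rid ∉? ballIdsAt v

      old : List (TreeEntry a (deg G v))
      old = map (extendEntry (ideal₂ v)) (entries (inp v))

      sound : ∀ e → e ∈ extendedEntries (inp v) (ideal₁ v) (ideal₂ v) →
              ∃₂ λ u (Qu : Q u ≡ true) → Describes G ID (tree u Qu) v e
      sound e e∈ with ∈-++⁻ old e∈
      ... | inj₁ e∈old with ∈-map⁻ (extendEntry (ideal₂ v)) e∈old
      ...   | e₀ , e₀∈ , refl with proj₁ encoded e₀ e₀∈
      ...     | u , Qu , d = u , Qu , oldEntry-describes Qu d
      sound e e∈ | inj₂ e∈new with ∈-map⁻ (newEntry (ideal₁ v)) e∈new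
      ... | rid , rid∈ , refl with ∈-filter⁻ notOwn? {xs = gather (ideal₁ v)} rid∈
      ... | rid∈gather , rid∉own with ∈-gather⁻ (ideal₁ v) rid∈gather
      ... | p , rid∈p with proj₁ (known (nbr G v p) rid) (subst (rid ∈_) (lookup-ideal₁ v p) rid∈p)
      ... | u , (yu , Qu) , refl = u , Qu , newEntry-describes Qu p (λ uv → rid∉own (∈ballIdsAt⁺ Qu uv)) (Within-sym yu)

      complete : ∀ u (Qu : Q u ≡ true) → Within G (suc s) u v →
                 ∃ λ e → e ∈ extendedEntries (inp v) (ideal₁ v) (ideal₂ v) × Describes G ID (tree u Qu) v e
      complete u Qu uv = byDepth (within? s u v)
        where
        Goal : Set
        Goal = ∃ λ e → e ∈ extendedEntries (inp v) (ideal₁ v) (ideal₂ v) × Describes G ID (tree u Qu) v e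

        viaNeighbour : ¬ Within G s u v → (∃ λ y → Within G s u y × Adj G y v) → Goal
        viaNeighbour ¬uv (y , uy , yv) with Adj-sym yv
        ... | p , refl =
          newEntry (ideal₁ v) (ID u) ,
          ∈-++⁺ʳ old (∈-map⁺ (newEntry (ideal₁ v))
            (∈-filter⁺ notOwn? (∈-gather⁺ {V = ideal₁ v} p (∈ideal₁⁺ p Qu uy))
                                (λ u∈own → ¬uv (∈ballIdsAt⁻ u∈own)))) ,
          newEntry-describes Qu p ¬uv uy

        byDepth : Dec (Within G s u v) → Goal
        byDepth (yes uv′) = let e₀ , e₀∈ , d = proj₂ encoded u Qu uv′ in
          extendEntry (ideal₂ v) e₀ , ∈-++⁺ˡ (∈-map⁺ (extendEntry (ideal₂ v)) e₀∈) , oldEntry-describes Qu d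
        byDepth (no ¬uv)  = viaNeighbour ¬uv (Within-last uv (λ { refl → ¬uv here }))

  algorithm-correct : ∀ {n} (G : Graph n) (Q : Fin n → Bool) (ID : Fin n → Id a) →
                      Injective _≡_ _≡_ ID → (∀ v → CardLe (BallQ G s v Q) D) → (Tf : TreeFamily G s Q) →
                      (inp : (v : Fin n) → In2 a (deg G v)) → ValidIn2 G Q ID s Tf inp →
                      Σ (TreeFamily G (suc s) Q) λ Tf′ →
                        (∀ u q → Extends G (Tf u q) (Tf′ u q)) ×
                        (∀ v → Encodes G ID Tf′ v (result algorithm G inp (T + T) v))
  algorithm-correct G Q ID inj card Tf inp valid =
    tree , Grown.extendBFS-extends , λ v →
      subst (Encodes G ID tree v) (sym (Protocol.Run.result-exchange G inp fits₁ fits₂ v)) (encodes v)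
    where open Correctness G Q ID inj card Tf inp valid

lemma4p1 : ∃ λ (C : ℕ) → ∀ (s D a b : ℕ) → 1 ≤ s → 1 ≤ D → 1 ≤ b →
    (Σ (Algorithm b (In1 a) (Out1 a)) λ A → Σ ℕ λ R → R * b ≤ C * (D * a + b) ×
      (∀ (n : ℕ) (G : Graph n) (Q : Fin n → Bool) (ID : Fin n → Id a) →
        Injective _≡_ _≡_ ID →
        (∀ v → CardLe (BallQ G s v Q) D) →
        (inp : (v : Fin n) → In1 a (deg G v)) → ValidIn1 G Q ID s inp →
        ∀ v → KnowsIds ID (BallQ G (suc s) v Q) (result A G inp R v)))
  × (Σ (Algorithm b (In2 a) (Out2 a)) λ A → Σ ℕ λ R → R * b ≤ C * (D * a + b) ×
      (∀ (n : ℕ) (G : Graph n) (Q : Fin n → Bool) (ID : Fin n → Id a) →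
        Injective _≡_ _≡_ ID →
        (∀ v → CardLe (BallQ G s v Q) D) →
        (Tf : TreeFamily G s Q) →
        (inp : (v : Fin n) → In2 a (deg G v)) → ValidIn2 G Q ID s Tf inp →
        Σ (TreeFamily G (suc s) Q) λ Tf' →
          (∀ u q → Extends G (Tf u q) (Tf' u q)) ×
          (∀ v → Encodes G ID Tf' v (result A G inp R v))))
lemma4p1 = 8 , λ where
  s zero    a b       _ () _
  s (suc d) a zero    _ _  ()
  s (suc d) a (suc b) _ _  _ →
    let open Schedule (suc d) a (suc b) in
    (NextBallIds.algorithm s (suc d) a (suc b) , T + T , rounds-cost d a b ,
     λ _ → NextBallIds.algorithm-correct s (suc d) a (suc b)) ,
    (ExtendTrees.algorithm s (suc d) a (suc b) , T + T , rounds-cost d a b ,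
     λ _ → ExtendTrees.algorithm-correct s (suc d) a (suc b))
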